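{- Let $G$ be a connected $3K_1$-free graph and let $u,v$ be distinct vertices of $G$. Then $G$ has a Hamiltonian path with end-vertices $u$ and $v$ if and only if (a) neither $u$ nor $v$ is an articulation point of $G$, and (b) for every articulation point $x$ of $G$, the vertices $u$ and $v$ belong to different connected components of $G-\{x\}$, and (c) $\{u,v\}$ is not a minimum vertex cut of $G$. Moreover, this happens if and only if $G$ satisfies (a), (b) and (c') $\{u,v\}$ is not a vertex cut of size two in $G$.
   Context: Graphs are finite, simple and undirected. A graph is $3K_1$-free if it contains no three pairwise non-adjacent vertices (i.e., its independence number is at most 2). A Hamiltonian path is a path containing all vertices of the graph. A vertex cut of $G$ is a set $A\subset V(G)$ such that $G-A$ is disconnected; an articulation point is a vertex $x$ such that $\{x\}$ is a vertex cut. The vertex connectivity of $G$ is the minimum size of a vertex cut (or $|V(G)|-1$ if $G$ is complete), and a minimum vertex cut is a vertex cut whose size equals the vertex connectivity. -}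

module Defs where

open import Data.Nat using (ℕ; _≤_)
open import Data.Fin using (Fin)
open import Data.Fin.Subset using (Subset; _∈_; _∉_; ⁅_⁆; _∪_; ∣_∣; ⊥)
open import Data.List using (List; []; _∷_)
open import Data.List.Relation.Unary.Unique.Propositional using (Unique)
import Data.List.Membership.Propositional as LM
open import Data.Product using (Σ; _×_; ∃; ∃-syntax)
open import Relation.Nullary using (¬_; Dec)
open import Relation.Binary.PropositionalEquality using (_≡_; _≢_)

record Graph (n : ℕ) : Set₁ where
  field
    E      : Fin n → Fin n → Set
    E-dec  : ∀ x y → Dec (E x y)
    E-sym  : ∀ {x y} → E x y → E y x
    E-irr  : ∀ {x} → ¬ E x x

module _ {n : ℕ} (G : Graph n) where
  open Graph G

  -- Walks in G - A from x to y (all vertices, including ends, avoid A).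
  data Reach (A : Subset n) : Fin n → Fin n → Set where
    here : ∀ {x} → x ∉ A → Reach A x x
    step : ∀ {x y z} → x ∉ A → E x y → Reach A y z → Reach A x z

  Connected : Set
  Connected = ∀ x y → Reach ⊥ x y

  VertexCut : Subset n → Set
  VertexCut A = ∃[ x ] ∃[ y ] (x ∉ A × y ∉ A × ¬ Reach A x y)

  ArticulationPoint : Fin n → Set
  ArticulationPoint x = VertexCut ⁅ x ⁆

  MinimumVertexCut : Subset n → Set
  MinimumVertexCut A = VertexCut A × (∀ B → VertexCut B → ∣ A ∣ ≤ ∣ B ∣)

  ThreeK1Free : Set
  ThreeK1Free = ∀ x y z → x ≢ y → y ≢ z → x ≢ z →
    ¬ (¬ E x y × ¬ E y z × ¬ E x z)

  data IsPath : Fin n → Fin n → List (Fin n) → Set where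
    single : ∀ {x} → IsPath x x (x ∷ [])
    cons   : ∀ {x y z ps} → E x y → IsPath y z (y ∷ ps) → IsPath x z (x ∷ y ∷ ps)

  HamiltonianPath : Fin n → Fin n → Set
  HamiltonianPath u v = Σ (List (Fin n)) λ p →
    IsPath u v p × Unique p × (∀ w → w LM.∈ p)

-- Necessity: along a Hamiltonian u–v path, deleting a vertex x leaves the part before x
-- connected to u and the part after x connected to v, and deleting u and v leaves the interior
-- connected.
-- Sufficiency: take a longest u–v path P. In a 3K₁-free graph no path outside P joins an
-- interior vertex of P to another vertex of P: if x … r₁ … r₂ … y were such a path, then r₁ and
-- the successors of x and y on P would be pairwise non-adjacent, since each possible edge lets
-- the path be spliced into P. So let w ∉ P have a neighbour y on P. If y is interior, y separates
-- w from u while uv is an edge (3K₁-freeness at w, u, v), against (b). If y is an end, say u,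
-- then either u separates w from v, against (a), or w leads outside P to a neighbour of v; the
-- resulting cycle leaves no articulation point by (b), and makes {u, v} a cut, hence a minimum
-- one, against (c). Finally (c') implies (c).
module Submission where

open import Defs
open import Data.Nat as ℕ using (ℕ; zero; suc; _+_; _≤_; _<_; _≤?_)
import Data.Nat.Properties as ℕ
open import Data.Fin as Fin using (Fin; _≟_)
import Data.Fin.Properties as Fin
open import Data.Fin.Subset as Subset using (Subset; _∉_; ⁅_⁆; _∪_; _⊆_; ∣_∣; inside; outside)
open import Data.Vec using ([]; _∷_)
import Data.Fin.Subset.Properties as Subset
open import Data.List using (List; []; _∷_; _++_; [_]; reverse; length; lookup)
open import Data.List.Properties using (++-assoc; reverse-++; unfold-reverse; length-++; length-reverse)
open import Data.List.Reverse using (reverseView; []; _∶_∶ʳ_)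
open import Data.List.Membership.Propositional using (_∈_)
open import Data.List.Membership.Propositional.Properties using (∈-∃++; ∈-++⁺ˡ; ∈-++⁺ʳ; ∈-++⁻; ∈-lookup)
import Data.List.Membership.DecPropositional as DecMembership
open import Data.List.Relation.Unary.Any using (here; there)
import Data.List.Relation.Unary.Any.Properties as Any
open import Data.List.Relation.Unary.All.Properties using (¬Any⇒All¬)
open import Data.List.Relation.Unary.All as All using (All; []; _∷_)
open import Data.List.Relation.Unary.AllPairs using ([]; _∷_)
open import Data.List.Relation.Unary.Unique.Propositional using (Unique)
import Data.List.Relation.Unary.Unique.Propositional.Properties as Unique
import Data.List.Relation.Unary.Unique.DecPropositional as DecUnique
open import Data.List.Relation.Binary.Disjoint.Propositional using (Disjoint)
open import Data.List.Relation.Binary.Permutation.Propositional using (_↭_; ↭-sym; ↭-trans; ↭-reflexive; ↭⇒↭ₛ)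
open import Data.List.Relation.Binary.Permutation.Propositional.Properties
  using (++⁺ˡ; ++⁺ʳ; ++-comm; ↭-reverse; ↭-length)
import Data.List.Relation.Binary.Permutation.Setoid.Properties as Permutationₛ
open import Data.Product using (∃-syntax; _×_; _,_; proj₁; proj₂)
open import Data.Sum using (inj₁; inj₂)
open import Data.Empty using (⊥-elim) renaming (⊥ to Empty)
open import Function using (_∘_; id; case_of_)
open import Function.Bundles using (_⇔_; mk⇔)
open import Relation.Nullary using (¬_; Dec; yes; no)
open import Relation.Nullary.Decidable using (_×-dec_; map′; decidable-stable)
open import Relation.Binary.PropositionalEquality
  using (_≡_; _≢_; refl; sym; trans; cong; subst; subst₂; cong₂; setoid; module ≡-Reasoning)

module _ {A : Set} where

  Unique-resp-↭ : ∀ {xs ys : List A} → xs ↭ ys → Unique xs → Unique ys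
  Unique-resp-↭ p = Permutationₛ.Unique-resp-↭ (setoid A) (↭⇒↭ₛ p)

  Unique-reverse : ∀ {xs : List A} → Unique xs → Unique (reverse xs)
  Unique-reverse {xs} = Unique-resp-↭ (↭-sym (↭-reverse xs))

  Unique-++⁻ʳ : ∀ (xs : List A) {ys} → Unique (xs ++ ys) → Unique ys
  Unique-++⁻ʳ []       u       = u
  Unique-++⁻ʳ (x ∷ xs) (_ ∷ u) = Unique-++⁻ʳ xs u

  Unique-∉-prefix : ∀ (xs : List A) {x ys} → Unique (xs ++ x ∷ ys) → All (x ≢_) xs
  Unique-∉-prefix []       u       = []
  Unique-∉-prefix (y ∷ xs) (a ∷ u) =
    (λ y≡x → All.lookup a (∈-++⁺ʳ xs (here refl)) (sym y≡x)) ∷ Unique-∉-prefix xs u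

  Unique-∉-suffix : ∀ (xs : List A) {x ys} → Unique (xs ++ x ∷ ys) → All (x ≢_) ys
  Unique-∉-suffix xs u with Unique-++⁻ʳ xs u
  ... | a ∷ _ = a

  reverse-++-∷ : ∀ (xs : List A) {x} ys → reverse (xs ++ x ∷ ys) ≡ reverse ys ++ x ∷ reverse xs
  reverse-++-∷ xs {x} ys = begin
    reverse (xs ++ x ∷ ys)            ≡⟨ reverse-++ xs (x ∷ ys) ⟩
    reverse (x ∷ ys) ++ reverse xs    ≡⟨ cong (_++ reverse xs) (unfold-reverse x ys) ⟩
    (reverse ys ++ [ x ]) ++ reverse xs ≡⟨ ++-assoc (reverse ys) [ x ] (reverse xs) ⟩
    reverse ys ++ x ∷ reverse xs      ∎
    where open ≡-Reasoning

  middle↭end : ∀ (xs ys zs : List A) → xs ++ ys ++ zs ↭ (xs ++ zs) ++ ys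
  middle↭end xs ys zs = ↭-trans (++⁺ˡ xs (++-comm ys zs)) (↭-reflexive (sym (++-assoc xs zs ys)))

lookup-injective : ∀ {m} {xs : List (Fin m)} → Unique xs → ∀ {i j} → i Fin.< j → lookup xs i ≢ lookup xs j
lookup-injective {xs = x ∷ xs} (a ∷ u) {Fin.zero}  {Fin.suc j} _            = All.lookup a (∈-lookup {xs = xs} j)
lookup-injective {xs = x ∷ xs} (a ∷ u) {Fin.suc i} {Fin.suc j} (ℕ.s≤s i<j) = lookup-injective u i<j

Unique⇒length≤ : ∀ {m} {xs : List (Fin m)} → Unique xs → length xs ≤ m
Unique⇒length≤ {xs = xs} u = ℕ.≮⇒≥ λ m<len →
  let (i , j , i<j , same) = Fin.pigeonhole m<len (lookup xs) in lookup-injective u i<j same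

any-list≤? : ∀ {m} k {P : List (Fin m) → Set} → (∀ xs → Dec (P xs)) →
  Dec (∃[ xs ] length xs ≤ k × P xs)
any-list≤? k P? with P? []
... | yes p = yes ([] , ℕ.z≤n , p)
any-list≤? zero    P? | no ¬p = no λ { ([] , _ , p) → ¬p p ; (_ ∷ _ , () , _) }
any-list≤? (suc k) P? | no ¬p = map′
  (λ (x , xs , le , p) → x ∷ xs , ℕ.s≤s le , p)
  (λ { ([] , _ , p) → ⊥-elim (¬p p) ; (x ∷ xs , ℕ.s≤s le , p) → x , xs , le , p })
  (Fin.any? λ x → any-list≤? k (P? ∘ (x ∷_)))

∣p∪q∣≤∣p∣+∣q∣ : ∀ {m} (p q : Subset m) → ∣ p ∪ q ∣ ≤ ∣ p ∣ + ∣ q ∣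
∣p∪q∣≤∣p∣+∣q∣ [] [] = ℕ.z≤n
∣p∪q∣≤∣p∣+∣q∣ (inside ∷ p) (inside ∷ q) =
  ℕ.s≤s (ℕ.≤-trans (∣p∪q∣≤∣p∣+∣q∣ p q) (ℕ.+-monoʳ-≤ ∣ p ∣ (ℕ.n≤1+n _)))
∣p∪q∣≤∣p∣+∣q∣ (inside ∷ p) (outside ∷ q) = ℕ.s≤s (∣p∪q∣≤∣p∣+∣q∣ p q)
∣p∪q∣≤∣p∣+∣q∣ (outside ∷ p) (inside ∷ q) =
  subst (suc ∣ p ∪ q ∣ ≤_) (sym (ℕ.+-suc ∣ p ∣ ∣ q ∣)) (ℕ.s≤s (∣p∪q∣≤∣p∣+∣q∣ p q))
∣p∪q∣≤∣p∣+∣q∣ (outside ∷ p) (outside ∷ q) = ∣p∪q∣≤∣p∣+∣q∣ p q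

module _ {n : ℕ} where
  private
    variable
      x y z : Fin n
      L : List (Fin n)

  ∉-pair : z ≢ x → z ≢ y → z ∉ ⁅ x ⁆ ∪ ⁅ y ⁆
  ∉-pair {z} {x} {y} z≢x z≢y z∈ with Subset.x∈p∪q⁻ ⁅ x ⁆ ⁅ y ⁆ z∈
  ... | inj₁ z∈x = z≢x (Subset.x∈⁅y⁆⇒x≡y x z∈x)
  ... | inj₂ z∈y = z≢y (Subset.x∈⁅y⁆⇒x≡y y z∈y)

  ∉-pair⁻ : z ∉ ⁅ x ⁆ ∪ ⁅ y ⁆ → z ≢ x × z ≢ y
  ∉-pair⁻ {z} z∉ = (λ { refl → z∉ (Subset.x∈p∪q⁺ (inj₁ (Subset.x∈⁅x⁆ z))) })
             , (λ { refl → z∉ (Subset.x∈p∪q⁺ (inj₂ (Subset.x∈⁅x⁆ z))) })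

  avoid-singleton : All (x ≢_) L → All (_∉ ⁅ x ⁆) L
  avoid-singleton = All.map λ x≢z → Subset.x≢y⇒x∉⁅y⁆ (x≢z ∘ sym)

  ∣⁅x⁆∪⁅y⁆∣≤2 : ∀ (x y : Fin n) → ∣ ⁅ x ⁆ ∪ ⁅ y ⁆ ∣ ≤ 2
  ∣⁅x⁆∪⁅y⁆∣≤2 x y = subst (∣ ⁅ x ⁆ ∪ ⁅ y ⁆ ∣ ≤_) (cong₂ _+_ (Subset.∣⁅x⁆∣≡1 x) (Subset.∣⁅x⁆∣≡1 y))
    (∣p∪q∣≤∣p∣+∣q∣ ⁅ x ⁆ ⁅ y ⁆)

  distinct∈⇒2≤∣p∣ : ∀ {p} → x Subset.∈ p → y Subset.∈ p → x ≢ y → 2 ≤ ∣ p ∣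
  distinct∈⇒2≤∣p∣ {x} {y} {p} x∈p y∈p x≢y = subst (_< ∣ p ∣) (Subset.∣⁅x⁆∣≡1 x)
    (ℕ.<-≤-trans (Subset.p⊂q⇒∣p∣<∣q∣ x⊂xy) (Subset.p⊆q⇒∣p∣≤∣q∣ xy⊆p))
    where
      x⊂xy : ⁅ x ⁆ Subset.⊂ ⁅ x ⁆ ∪ ⁅ y ⁆
      x⊂xy = Subset.p⊆p∪q ⁅ y ⁆ , y , Subset.x∈p∪q⁺ (inj₂ (Subset.x∈⁅x⁆ y)) , Subset.x≢y⇒x∉⁅y⁆ (x≢y ∘ sym)
      xy⊆p : ⁅ x ⁆ ∪ ⁅ y ⁆ ⊆ p
      xy⊆p z∈ with Subset.x∈p∪q⁻ ⁅ x ⁆ ⁅ y ⁆ z∈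
      ... | inj₁ z∈x rewrite Subset.x∈⁅y⁆⇒x≡y x z∈x = x∈p
      ... | inj₂ z∈y rewrite Subset.x∈⁅y⁆⇒x≡y y z∈y = y∈p

  ∈-tail : z ∉ ⁅ x ⁆ → z ∈ x ∷ L → z ∈ L
  ∈-tail z∉ (here refl) = ⊥-elim (z∉ (Subset.x∈⁅x⁆ _))
  ∈-tail z∉ (there z∈L) = z∈L

module Paths {n : ℕ} (G : Graph n) where
  open Graph G
  open DecMembership (_≟_ {n}) using (_∈?_)

  private
    variable
      A B : Subset n
      a b r s t x y z : Fin n
      L M Q : List (Fin n)

  reach-start∉ : Reach G A x y → x ∉ A
  reach-start∉ (here x∉A)     = x∉A
  reach-start∉ (step x∉A _ _) = x∉A

  reach-snoc : Reach G A x y → E y z → z ∉ A → Reach G A x z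
  reach-snoc (here x∉A)       e z∉A = step x∉A e (here z∉A)
  reach-snoc (step x∉A e′ xy) e z∉A = step x∉A e′ (reach-snoc xy e z∉A)

  reach-sym : Reach G A x y → Reach G A y x
  reach-sym (here x∉A)      = here x∉A
  reach-sym (step x∉A e xy) = reach-snoc (reach-sym xy) (E-sym e) x∉A

  reach-trans : Reach G A x y → Reach G A y z → Reach G A x z
  reach-trans (here _)        yz = yz
  reach-trans (step x∉A e xy) yz = step x∉A e (reach-trans xy yz)

  reach-mono : B ⊆ A → Reach G A x y → Reach G B x y
  reach-mono B⊆A (here x∉A)      = here (x∉A ∘ B⊆A)
  reach-mono B⊆A (step x∉A e xy) = step (x∉A ∘ B⊆A) e (reach-mono B⊆A xy)

  path-head : IsPath G s t (x ∷ L) → x ≡ s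
  path-head single     = refl
  path-head (cons _ _) = refl

  path-start∈ : IsPath G s t L → s ∈ L
  path-start∈ single     = here refl
  path-start∈ (cons _ _) = here refl

  path-end∈ : IsPath G s t L → t ∈ L
  path-end∈ single     = here refl
  path-end∈ (cons _ p) = there (path-end∈ p)

  path-tail : IsPath G s t (s ∷ x ∷ L) → IsPath G x t (x ∷ L)
  path-tail (cons _ p) = p

  path-prepend : E x r → IsPath G r t L → IsPath G x t (x ∷ L)
  path-prepend e single     = cons e single
  path-prepend e (cons e′ p) = cons e (cons e′ p)

  path-join : IsPath G s a L → E a b → IsPath G b t M → IsPath G s t (L ++ M)
  path-join single      e q = path-prepend e q
  path-join (cons e′ p) e q = cons e′ (path-join p e q)

  path-reverse : IsPath G s t L → IsPath G t s (reverse L)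
  path-reverse single = single
  path-reverse {L = x ∷ y ∷ L} (cons e p) =
    subst (IsPath G _ x) (sym (unfold-reverse x (y ∷ L))) (path-join (path-reverse p) (E-sym e) single)

  path-suffix : ∀ L → IsPath G s t (L ++ a ∷ M) → IsPath G a t (a ∷ M)
  path-suffix []          p with refl ← path-head p = p
  path-suffix (_ ∷ [])     (cons _ p) = p
  path-suffix (_ ∷ y ∷ L) (cons _ p) = path-suffix (y ∷ L) p

  path-prefix : ∀ L → IsPath G s t (L ++ a ∷ M) → IsPath G s a (L ++ [ a ])
  path-prefix []          p with refl ← path-head p = single
  path-prefix (_ ∷ [])     (cons e p) with refl ← path-head p = cons e single
  path-prefix (_ ∷ y ∷ L) (cons e p) = cons e (path-prefix (y ∷ L) p)

  path-last : ∀ L → IsPath G s t (L ++ [ a ]) → a ≡ t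
  path-last L p with single ← path-suffix L p = refl

  path-nonempty : IsPath G s t L → 1 ≤ length L
  path-nonempty single     = ℕ.s≤s ℕ.z≤n
  path-nonempty (cons _ _) = ℕ.s≤s ℕ.z≤n

  reach-along-prefix : IsPath G s t (L ++ M) → All (_∉ A) L → a ∈ L → Reach G A s a
  reach-along-prefix p (a∉A ∷ _) (here refl) with refl ← path-head p = here a∉A
  reach-along-prefix {L = _ ∷ _ ∷ _} (cons e p) (s∉A ∷ av) (there a∈L) =
    step s∉A e (reach-along-prefix p av a∈L)

  reach-along-suffix : ∀ L → IsPath G s t (L ++ M) → All (_∉ A) M → a ∈ M → Reach G A a t
  reach-along-suffix {M = M} L p av a∈M = reach-sym (reach-along-prefix
    (subst (IsPath G _ _) (reverse-++ L M) (path-reverse p))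
    (All.tabulate (All.lookup av ∘ Any.reverse⁻)) (Any.reverse⁺ a∈M))

  reach-along-init : IsPath G s t L → Unique L → (∀ {z} → z ∈ L → z ≢ t → z ∉ A) →
    a ∈ L → a ≢ t → Reach G A s a
  reach-along-init {L = L} p u av a∈L a≢t with reverseView L
  ... | M ∶ _ ∶ʳ l with refl ← path-last M p with ∈-++⁻ M a∈L
  ...   | inj₁ a∈M = reach-along-prefix p
          (All.zipWith (λ (l≢z , z∈M) → av (∈-++⁺ˡ z∈M) (l≢z ∘ sym)) (Unique-∉-prefix M u , All.tabulate id)) a∈M
  ...   | inj₂ (here refl) = ⊥-elim (a≢t refl)

  2≤∣cut∣ : Connected G → (∀ x → ¬ ArticulationPoint G x) → VertexCut G B → 2 ≤ ∣ B ∣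
  2≤∣cut∣ {B} conn no-articulation (x , y , x∉B , y∉B , ¬xy) with 2 ≤? ∣ B ∣ | Subset.nonempty? B
  ... | yes 2≤∣B∣ | _ = 2≤∣B∣
  ... | no _ | no empty = ⊥-elim (¬xy (reach-mono (λ z∈B → ⊥-elim (empty (_ , z∈B))) (conn x y)))
  ... | no 2≰∣B∣ | yes (a , a∈B) = ⊥-elim (no-articulation a
        (x , y , x∉B ∘ a∈⁅⁆⇒∈B , y∉B ∘ a∈⁅⁆⇒∈B , ¬xy ∘ reach-mono B⊆⁅a⁆))
    where
      a∈⁅⁆⇒∈B : ∀ {z} → z Subset.∈ ⁅ a ⁆ → z Subset.∈ B
      a∈⁅⁆⇒∈B z∈a rewrite Subset.x∈⁅y⁆⇒x≡y a z∈a = a∈B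
      B⊆⁅a⁆ : B ⊆ ⁅ a ⁆
      B⊆⁅a⁆ {z} z∈B with z ≟ a
      ... | yes refl = Subset.x∈⁅x⁆ z
      ... | no z≢a = ⊥-elim (2≰∣B∣ (distinct∈⇒2≤∣p∣ z∈B a∈B z≢a))

  pair-cut-minimum : Connected G → (∀ x → ¬ ArticulationPoint G x) →
    VertexCut G (⁅ s ⁆ ∪ ⁅ t ⁆) → MinimumVertexCut G (⁅ s ⁆ ∪ ⁅ t ⁆)
  pair-cut-minimum {s} {t} conn no-articulation cut =
    cut , λ B B-cut → ℕ.≤-trans (∣⁅x⁆∪⁅y⁆∣≤2 s t) (2≤∣cut∣ conn no-articulation B-cut)

  isPath? : ∀ s t L → Dec (IsPath G s t L)
  isPath? s t []          = no λ ()
  isPath? s t (x ∷ [])    with x ≟ s | x ≟ t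
  ... | yes refl | yes refl = yes single
  ... | no x≢s   | _        = no λ { single → x≢s refl }
  ... | _        | no x≢t   = no λ { single → x≢t refl }
  isPath? s t (x ∷ y ∷ L) with x ≟ s | E-dec x y | isPath? y t (y ∷ L)
  ... | yes refl | yes e | yes p = yes (cons e p)
  ... | no x≢s   | _     | _     = no λ { (cons _ _) → x≢s refl }
  ... | _        | no ¬e | _     = no λ { (cons e _) → ¬e e }
  ... | _        | _     | no ¬p = no λ { (cons _ p) → ¬p p }

  hamiltonian? : ∀ u v → Dec (HamiltonianPath G u v)
  hamiltonian? u v =
    map′ (λ (L , _ , ham) → L , ham) (λ (L , ham) → L , Unique⇒length≤ (proj₁ (proj₂ ham)) , ham)
    (any-list≤? n λ L → isPath? u v L ×-dec (DecUnique.unique? (_≟_ {n}) L ×-dec Fin.all? (_∈? L)))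

  SimplePath : Fin n → Fin n → Set
  SimplePath x y = ∃[ Q ] IsPath G x y Q × Unique Q

  -- Loop erasure: if x is already on the path, keep only the part from x on.
  prepend-simple : E x r → IsPath G r y Q → Unique Q →
    ∃[ Q′ ] (IsPath G x y Q′ × Unique Q′ × (∀ {z} → z ∈ Q′ → z ∈ x ∷ Q))
  prepend-simple {x = x} {Q = Q} e q u with x ∈? Q
  ... | yes x∈Q with L , M , refl ← ∈-∃++ x∈Q =
    x ∷ M , path-suffix L q , Unique-++⁻ʳ L u , there ∘ ∈-++⁺ʳ L
  ... | no x∉Q = x ∷ Q , path-prepend e q , ¬Any⇒All¬ Q x∉Q ∷ u , λ z∈ → z∈

  simple-path : Reach G A x y → SimplePath x y
  simple-path (here _) = _ , single , [] ∷ []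
  simple-path (step _ e xy) with _ , q , u ← simple-path xy
                            with Q′ , q′ , u′ , _ ← prepend-simple e q u = Q′ , q′ , u′

module Necessity {n : ℕ} (G : Graph n) where
  open Paths G

  private
    variable
      u v : Fin n

  hamiltonian-reverse : HamiltonianPath G u v → HamiltonianPath G v u
  hamiltonian-reverse (L , p , uL , cover) = reverse L , path-reverse p , Unique-reverse uL , Any.reverse⁺ ∘ cover

  hamiltonian⇒start-¬articulation : u ≢ v → HamiltonianPath G u v → ¬ ArticulationPoint G u
  hamiltonian⇒start-¬articulation u≢v (_ , single , _) _ = u≢v refl
  hamiltonian⇒start-¬articulation {u} {v} _ (_ , p@(cons _ _) , u∉R ∷ _ , cover) (_ , _ , a∉ , b∉ , ¬ab) =
    ¬ab (reach-trans (to-v a∉) (reach-sym (to-v b∉)))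
    where
      to-v : ∀ {z} → z ∉ ⁅ u ⁆ → Reach G ⁅ u ⁆ z v
      to-v z∉ = reach-along-suffix [ u ] p (avoid-singleton u∉R) (∈-tail z∉ (cover _))

  hamiltonian⇒articulation-separates : HamiltonianPath G u v → ∀ x → ArticulationPoint G x → ¬ Reach G ⁅ x ⁆ u v
  hamiltonian⇒articulation-separates {u} (_ , p , uL , cover) x (_ , _ , a∉ , b∉ , ¬ab) uv
    with X , Y , refl ← ∈-∃++ (cover x) = ¬ab (reach-trans (to-u a∉) (reach-sym (to-u b∉)))
    where
      to-u : ∀ {z} → z ∉ ⁅ x ⁆ → Reach G ⁅ x ⁆ z u
      to-u {z} z∉ with ∈-++⁻ X (cover z)
      ... | inj₁ z∈X = reach-sym (reach-along-prefix p (avoid-singleton (Unique-∉-prefix X uL)) z∈X)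
      ... | inj₂ z∈xY = reach-trans
        (reach-along-suffix [ x ] (path-suffix X p) (avoid-singleton (Unique-∉-suffix X uL)) (∈-tail z∉ z∈xY))
        (reach-sym uv)

  hamiltonian⇒ends-¬cut : u ≢ v → HamiltonianPath G u v → ¬ VertexCut G (⁅ u ⁆ ∪ ⁅ v ⁆)
  hamiltonian⇒ends-¬cut u≢v (_ , single , _) _ = u≢v refl
  hamiltonian⇒ends-¬cut {u} {v} _ (_ , cons {y = y} _ q , u∉R ∷ uR , cover) (_ , _ , a∉ , b∉ , ¬ab) =
    ¬ab (reach-trans (reach-sym (from-start a∉)) (from-start b∉))
    where
      from-start : ∀ {z} → z ∉ ⁅ u ⁆ ∪ ⁅ v ⁆ → Reach G (⁅ u ⁆ ∪ ⁅ v ⁆) y z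
      from-start z∉ = reach-along-init q uR
        (λ z∈R z≢v → ∉-pair (λ { refl → All.lookup u∉R z∈R refl }) z≢v)
        (∈-tail (Subset.x≢y⇒x∉⁅y⁆ (proj₁ (∉-pair⁻ z∉))) (cover _)) (proj₂ (∉-pair⁻ z∉))

module LongestPaths {n : ℕ} (G : Graph n) (free : ThreeK1Free G) where
  open Graph G
  open Paths G

  private
    variable
      r r₁ r₂ s t w x y : Fin n
      P P′ : List (Fin n)

  record Detour (P : List (Fin n)) (r w : Fin n) : Set where
    field
      route          : List (Fin n)
      route-path     : IsPath G r w route
      route-unique   : Unique route
      route-disjoint : Disjoint P route
  open Detour

  detour-start∉ : Detour P r w → ¬ r ∈ P
  detour-start∉ D r∈P = route-disjoint D (r∈P , path-start∈ (route-path D))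

  trivial-detour : ¬ w ∈ P → Detour P w w
  trivial-detour w∉P = record
    { route = _ ; route-path = single ; route-unique = [] ∷ []
    ; route-disjoint = λ { (w∈P , here refl) → w∉P w∈P } }

  reverse-detour : Detour P r w → Detour P w r
  reverse-detour D = record
    { route = reverse (route D) ; route-path = path-reverse (route-path D)
    ; route-unique = Unique-reverse (route-unique D)
    ; route-disjoint = λ (z∈P , z∈Q) → route-disjoint D (z∈P , Any.reverse⁻ z∈Q) }

  detour-mono : (∀ {z} → z ∈ P′ → z ∈ P) → Detour P r w → Detour P′ r w
  detour-mono P′⊆P D = record
    { route = route D ; route-path = route-path D ; route-unique = route-unique D
    ; route-disjoint = λ (z∈P′ , z∈Q) → route-disjoint D (P′⊆P z∈P′ , z∈Q) }

  extend-detour : Detour P r w → E x r → ¬ x ∈ P → Detour P x w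
  extend-detour D e x∉P with Q′ , q′ , u′ , Q′⊆ ← prepend-simple e (route-path D) (route-unique D) = record
    { route = Q′ ; route-path = q′ ; route-unique = u′
    ; route-disjoint = λ (z∈P , z∈Q′) → case Q′⊆ z∈Q′ of λ
        { (here refl) → x∉P z∈P ; (there z∈Q) → route-disjoint D (z∈P , z∈Q) } }

  record LongestPath (s t : Fin n) (P : List (Fin n)) : Set where
    field
      isPath  : IsPath G s t P
      unique  : Unique P
      longest : ∀ {P′} → IsPath G s t P′ → Unique P′ → ¬ length P < length P′
  open LongestPath

  reverse-longest : LongestPath s t P → LongestPath t s (reverse P)
  reverse-longest {P = P} LP = record
    { isPath = path-reverse (isPath LP) ; unique = Unique-reverse (unique LP)
    ; longest = λ {P′} p′ u′ longer → longest LP (path-reverse p′) (Unique-reverse u′)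
        (subst₂ _<_ (length-reverse P) (sym (length-reverse P′)) longer) }

  splice-longer : LongestPath s t P → (D : Detour P r₁ r₂) → ∀ L M → P ↭ L ++ M →
    ¬ IsPath G s t (L ++ route D ++ M)
  splice-longer {P = P} LP D L M P↭ p′ =
    longest LP p′ (Unique-resp-↭ (↭-sym spliced↭) P++Q-unique) longer
    where
      Q = route D
      spliced↭ : L ++ Q ++ M ↭ P ++ Q
      spliced↭ = ↭-trans (middle↭end L Q M) (++⁺ʳ Q (↭-sym P↭))
      P++Q-unique : Unique (P ++ Q)
      P++Q-unique = Unique.++⁺ (unique LP) (route-unique D) (route-disjoint D)
      longer : length P < length (L ++ Q ++ M)
      longer = ℕ.<-≤-trans (ℕ.m<m+n (length P) (path-nonempty (route-path D)))
        (ℕ.≤-reflexive (trans (sym (length-++ P)) (↭-length (↭-sym spliced↭))))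

  ¬detour-adjacent : LongestPath s t P → ∀ X {a b} Z → P ≡ X ++ a ∷ b ∷ Z →
    Detour P r₁ r₂ → E a r₁ → E r₂ b → Empty
  ¬detour-adjacent LP X {a} {b} Z refl D ea eb =
    splice-longer LP D (X ++ [ a ]) (b ∷ Z) (↭-reflexive (sym (++-assoc X [ a ] (b ∷ Z))))
      (path-join (path-prefix X p) ea (path-join (route-path D) eb (path-tail (path-suffix X p))))
    where p = isPath LP

  -- The detour replaces the edge a m, and the segment m … b is traversed backwards.
  ¬detour-crossing : LongestPath s t P → ∀ X {a m} M {b d} Z → P ≡ X ++ a ∷ m ∷ M ++ b ∷ d ∷ Z →
    Detour P r₁ r₂ → E a r₁ → E r₂ b → E m d → Empty
  ¬detour-crossing LP X {a} {m} M {b} {d} Z refl D ea eb emd =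
    splice-longer LP D (X ++ [ a ]) (reverse Y ++ d ∷ Z) P↭
      (path-join (path-prefix X p) ea (path-join (route-path D) eb (path-join (path-reverse mb) emd dt)))
    where
      p = isPath LP
      mt = path-tail (path-suffix X p)
      mb = path-prefix (m ∷ M) mt
      dt = path-tail (path-suffix (m ∷ M) mt)
      Y = m ∷ M ++ [ b ]
      P↭ : X ++ a ∷ m ∷ M ++ b ∷ d ∷ Z ↭ (X ++ [ a ]) ++ reverse Y ++ d ∷ Z
      P↭ = ↭-trans
        (↭-reflexive (begin
          X ++ a ∷ m ∷ M ++ b ∷ d ∷ Z     ≡⟨ cong (λ l → X ++ a ∷ m ∷ l) (++-assoc M [ b ] (d ∷ Z)) ⟨
          X ++ a ∷ Y ++ d ∷ Z             ≡⟨ ++-assoc X [ a ] (Y ++ d ∷ Z) ⟨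
          (X ++ [ a ]) ++ Y ++ d ∷ Z      ∎))
        (++⁺ˡ (X ++ [ a ]) (++⁺ʳ (d ∷ Z) (↭-sym (↭-reverse Y))))
        where open ≡-Reasoning

  -- With m the successor of a and d that of b, the three vertices r₁, m, d are not independent;
  -- each of the three possible edges lets the detour be spliced in.
  ¬detour-to-later : LongestPath s t P → ∀ X {a} M {b d} Z → P ≡ X ++ a ∷ M ++ b ∷ d ∷ Z →
    Detour P r₁ r₂ → E a r₁ → E r₂ b → Empty
  ¬detour-to-later LP X [] Z eq D ea eb = ¬detour-adjacent LP X (_ ∷ Z) eq D ea eb
  ¬detour-to-later {r₁ = r₁} LP X {a} (m ∷ M) {b} {d} Z refl D ea eb
    with E-dec r₁ m | E-dec r₁ d | E-dec m d
  ... | yes r₁m | _ | _ = ¬detour-adjacent LP X (M ++ b ∷ d ∷ Z) refl (trivial-detour (detour-start∉ D)) ea r₁m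
  ... | no _ | yes r₁d | _ = ¬detour-adjacent LP (X ++ a ∷ m ∷ M) Z (sym (++-assoc X (a ∷ m ∷ M) (b ∷ d ∷ Z)))
                               (reverse-detour D) (E-sym eb) r₁d
  ... | no _ | no _ | yes md = ¬detour-crossing LP X M Z refl D ea eb md
  ... | no ¬r₁m | no ¬r₁d | no ¬md with Unique-++⁻ʳ X (unique LP)
  ...   | _ ∷ m∉ ∷ _ = free r₁ m d (on-path (there (here refl))) (All.lookup m∉ (∈-++⁺ʳ M (there (here refl))))
                         (on-path (there (there (∈-++⁺ʳ M (there (here refl)))))) (¬r₁m , ¬md , ¬r₁d)
    where
      on-path : ∀ {z} → z ∈ a ∷ m ∷ M ++ b ∷ d ∷ Z → r₁ ≢ z
      on-path z∈ refl = detour-start∉ D (∈-++⁺ʳ X z∈)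

  ¬detour-to-earlier : LongestPath s t P → ∀ X {x} Y → P ≡ X ++ x ∷ Y → x ≢ t → y ∈ X →
    Detour P r₁ r₂ → E x r₁ → E r₂ y → Empty
  ¬detour-to-earlier LP X []      refl x≢t _ _ _ _ = x≢t (path-last X (isPath LP))
  ¬detour-to-earlier LP X (d ∷ Z) refl _ y∈X D ex ey with X₁ , M , refl ← ∈-∃++ y∈X =
    ¬detour-to-later LP X₁ M Z (++-assoc X₁ (_ ∷ M) (_ ∷ d ∷ Z)) (reverse-detour D) (E-sym ey) (E-sym ex)

  ¬detour-from-interior : LongestPath s t P → x ∈ P → x ≢ s → x ≢ t → y ∈ P → x ≢ y →
    Detour P r₁ r₂ → E x r₁ → E r₂ y → Empty
  ¬detour-from-interior LP x∈P x≢s x≢t y∈P x≢y D ex ey with X , Y , refl ← ∈-∃++ x∈P with ∈-++⁻ X y∈P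
  ... | inj₁ y∈X          = ¬detour-to-earlier LP X Y refl x≢t y∈X D ex ey
  ... | inj₂ (here refl)  = x≢y refl
  ... | inj₂ (there y∈Y)  = ¬detour-to-earlier (reverse-longest LP) (reverse Y) (reverse X) (reverse-++-∷ X Y)
                              x≢s (Any.reverse⁺ y∈Y) (detour-mono Any.reverse⁻ D) ex ey

  open DecMembership (_≟_ {n}) using (_∈?_)

  first-contact : ∀ {A z} → Detour P r w → Reach G A r z → z ∈ P →
    ∃[ r′ ] ∃[ c ] Detour P r′ w × E r′ c × c ∉ A × c ∈ P
  first-contact D (here _) z∈P = ⊥-elim (detour-start∉ D z∈P)
  first-contact {P = P} D (step {y = y} _ e yz) z∈P with y ∈? P
  ... | yes y∈P = _ , _ , D , e , reach-start∉ yz , y∈P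
  ... | no y∉P  = first-contact (extend-detour D (E-sym e) y∉P) yz z∈P

  separated : ∀ {A z} → ¬ w ∈ P → (∀ {r c} → Detour P r w → E r c → c ∉ A → c ∈ P → Empty) →
    z ∈ P → ¬ Reach G A w z
  separated w∉P no-contact z∈P wz
    with _ , _ , D , rc , c∉A , c∈P ← first-contact (trivial-detour w∉P) wz z∈P = no-contact D rc c∉A c∈P

module Sufficiency {n : ℕ} (G : Graph n) (conn : Connected G) (free : ThreeK1Free G) where
  open Graph G
  open Paths G
  open LongestPaths G free
  open LongestPath
  open Detour
  open DecMembership (_≟_ {n}) using (_∈?_)

  private
    variable
      r s t w y z : Fin n
      P : List (Fin n)

  ArticulationPointsSeparate : Fin n → Fin n → Set
  ArticulationPointsSeparate s t = ∀ x → ArticulationPoint G x → s ∉ ⁅ x ⁆ × t ∉ ⁅ x ⁆ × ¬ Reach G ⁅ x ⁆ s t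

  separate-sym : ArticulationPointsSeparate s t → ArticulationPointsSeparate t s
  separate-sym sep x ap with s∉ , t∉ , ¬st ← sep x ap = t∉ , s∉ , ¬st ∘ reach-sym

  off-path : ¬ w ∈ P → z ∈ P → w ≢ z
  off-path w∉P z∈P refl = w∉P z∈P

  interior-exit⇒ends-adjacent : LongestPath s t P → s ≢ t → y ∈ P → y ≢ s → y ≢ t → ¬ w ∈ P → E y w → E s t
  interior-exit⇒ends-adjacent {s} {t} {P} {y} {w} LP s≢t y∈P y≢s y≢t w∉P yw with E-dec s t
  ... | yes st = st
  ... | no ¬st = ⊥-elim (free w s t (off-path w∉P s∈P) s≢t (off-path w∉P t∈P)
                          (¬adjacent-elsewhere s∈P y≢s , ¬st , ¬adjacent-elsewhere t∈P y≢t))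
    where
      s∈P = path-start∈ (isPath LP)
      t∈P = path-end∈ (isPath LP)
      ¬adjacent-elsewhere : ∀ {z} → z ∈ P → y ≢ z → ¬ E w z
      ¬adjacent-elsewhere z∈P y≢z = ¬detour-from-interior LP y∈P y≢s y≢t z∈P y≢z (trivial-detour w∉P) yw

  interior-exit⇒articulation : LongestPath s t P → y ∈ P → y ≢ s → y ≢ t → ¬ w ∈ P → E y w → ArticulationPoint G y
  interior-exit⇒articulation {s} {t} {P} {y} {w} LP y∈P y≢s y≢t w∉P yw =
    w , s , Subset.x≢y⇒x∉⁅y⁆ (off-path w∉P y∈P) , Subset.x≢y⇒x∉⁅y⁆ (y≢s ∘ sym) ,
    separated w∉P no-contact (path-start∈ (isPath LP))
    where
      no-contact : ∀ {r c} → Detour P r w → E r c → c ∉ ⁅ y ⁆ → c ∈ P → Empty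
      no-contact D rc c∉ c∈P =
        ¬detour-from-interior LP y∈P y≢s y≢t c∈P (Subset.x∉⁅y⁆⇒x≢y c∉ ∘ sym) (reverse-detour D) yw rc

  ¬interior-exit : ArticulationPointsSeparate s t → LongestPath s t P → s ≢ t →
    y ∈ P → y ≢ s → y ≢ t → ¬ w ∈ P → ¬ E y w
  ¬interior-exit sep LP s≢t y∈P y≢s y≢t w∉P yw
    with s∉ , t∉ , ¬st ← sep _ (interior-exit⇒articulation LP y∈P y≢s y≢t w∉P yw) =
    ¬st (step s∉ (interior-exit⇒ends-adjacent LP s≢t y∈P y≢s y≢t w∉P yw) (here t∉))

  start-exit⇒articulation : LongestPath s t P → s ≢ t → ¬ w ∈ P → E s w →
    (∀ {r} → Detour P r w → ¬ E r t) → ArticulationPoint G s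
  start-exit⇒articulation {s} {t} {P} {w} LP s≢t w∉P sw no-return =
    w , t , Subset.x≢y⇒x∉⁅y⁆ (off-path w∉P s∈P) , Subset.x≢y⇒x∉⁅y⁆ (s≢t ∘ sym) ,
    separated w∉P no-contact (path-end∈ (isPath LP))
    where
      s∈P = path-start∈ (isPath LP)
      no-contact : ∀ {r c} → Detour P r w → E r c → c ∉ ⁅ s ⁆ → c ∈ P → Empty
      no-contact {c = c} D rc c∉ c∈P with c ≟ t
      ... | yes refl = no-return D rc
      ... | no c≢t   = ¬detour-from-interior LP c∈P (Subset.x∉⁅y⁆⇒x≢y c∉) c≢t s∈P (Subset.x∉⁅y⁆⇒x≢y c∉)
                         D (E-sym rc) (E-sym sw)

  -- Here s w … r t closes a cycle with P, so s and t stay connected after deleting any single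
  -- vertex; by condition (b) there is then no articulation point at all.
  start-exit⇒pair-cut-minimum : LongestPath s t P → s ≢ t → ¬ w ∈ P → E s w → ArticulationPointsSeparate s t →
    Detour P r w → E r t → MinimumVertexCut G (⁅ s ⁆ ∪ ⁅ t ⁆)
  start-exit⇒pair-cut-minimum LP s≢t w∉P sw sep D rt with isPath LP | unique LP
  ... | single           | _ = ⊥-elim (s≢t refl)
  ... | cons _ single    | _ = ⊥-elim (¬detour-adjacent LP [] [] refl (reverse-detour D) sw rt)
  start-exit⇒pair-cut-minimum {s} {t} {P} {w} LP s≢t w∉P sw sep D rt
      | cons {y = y} _ q@(cons _ _) | s∉ ∷ y∉ ∷ _ =
    pair-cut-minimum conn no-articulation
      (w , y , ∉-pair (off-path w∉P s∈P) (off-path w∉P t∈P) , ∉-pair y≢s y≢t , separated w∉P no-contact y∈P)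
    where
      p = isPath LP
      s∈P = path-start∈ p
      t∈P = path-end∈ p
      y∈P = there (here refl)
      y≢s = All.head s∉ ∘ sym
      y≢t = All.lookup y∉ (path-end∈ (path-tail q))
      no-contact : ∀ {r c} → Detour P r w → E r c → c ∉ ⁅ s ⁆ ∪ ⁅ t ⁆ → c ∈ P → Empty
      no-contact D′ rc c∉ c∈P with c≢s , c≢t ← ∉-pair⁻ c∉ =
        ¬detour-from-interior LP c∈P c≢s c≢t s∈P c≢s D′ (E-sym rc) (E-sym sw)
      no-articulation : ∀ x → ¬ ArticulationPoint G x
      no-articulation x ap with s∉x , t∉x , ¬st ← sep x ap with x ∈? P
      ... | no x∉P  = ¬st (reach-along-suffix [] p (avoid-singleton (¬Any⇒All¬ P x∉P)) s∈P)
      ... | yes x∈P = ¬st (step s∉x sw (reach-snoc (reach-sym (reach-along-suffix [] (route-path D) x∉Q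
                             (path-start∈ (route-path D)))) rt t∉x))
        where x∉Q = avoid-singleton (¬Any⇒All¬ _ λ x∈Q → route-disjoint D (x∈P , x∈Q))

  ¬start-exit : ¬ ArticulationPoint G s → ArticulationPointsSeparate s t → ¬ MinimumVertexCut G (⁅ s ⁆ ∪ ⁅ t ⁆) →
    LongestPath s t P → s ≢ t → ¬ w ∈ P → ¬ E s w
  ¬start-exit ¬art-s sep ¬min LP s≢t w∉P sw = ¬art-s (start-exit⇒articulation LP s≢t w∉P sw
    λ D rt → ¬min (start-exit⇒pair-cut-minimum LP s≢t w∉P sw sep D rt))

  module _ {u v : Fin n} (u≢v : u ≢ v) (¬art : ¬ ArticulationPoint G u × ¬ ArticulationPoint G v)
           (sep : ArticulationPointsSeparate u v) (¬min : ¬ MinimumVertexCut G (⁅ u ⁆ ∪ ⁅ v ⁆)) where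

    longest-covers : LongestPath u v P → ∀ z → z ∈ P
    longest-covers {P} LP z with z ∈? P
    ... | yes z∈P = z∈P
    ... | no z∉P
      with w , y , D , wy , _ , y∈P ← first-contact (trivial-detour z∉P) (conn z u) (path-start∈ (isPath LP))
      with y ≟ u | y ≟ v
    ...   | yes refl | _        = ⊥-elim (¬start-exit (proj₁ ¬art) sep ¬min LP u≢v (detour-start∉ D) (E-sym wy))
    ...   | no _     | yes refl = ⊥-elim (¬start-exit (proj₂ ¬art) (separate-sym sep)
                                    (¬min ∘ subst (MinimumVertexCut G) (Subset.∪-comm ⁅ v ⁆ ⁅ u ⁆))
                                    (reverse-longest LP) (u≢v ∘ sym) (detour-start∉ D ∘ Any.reverse⁻) (E-sym wy))
    ...   | no y≢u   | no y≢v   = ⊥-elim (¬interior-exit sep LP u≢v y∈P y≢u y≢v (detour-start∉ D) (E-sym wy))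

    -- k bounds n − length P, so the induction hypothesis refutes every longer path and P is longest.
    ¬hamiltonian⇒¬path : ¬ HamiltonianPath G u v → ∀ k → IsPath G u v P → Unique P → n < length P + k → Empty
    ¬hamiltonian⇒¬path ¬ham zero    p uP n<∣P∣ = ℕ.<⇒≱ (subst (n <_) (ℕ.+-identityʳ _) n<∣P∣) (Unique⇒length≤ uP)
    ¬hamiltonian⇒¬path {P} ¬ham (suc k) p uP n<∣P∣+k+1 = ¬ham (P , p , uP , longest-covers LP)
      where
        LP : LongestPath u v P
        LP = record
          { isPath = p ; unique = uP
          ; longest = λ p′ uP′ longer → ¬hamiltonian⇒¬path ¬ham k p′ uP′
              (ℕ.<-≤-trans n<∣P∣+k+1 (ℕ.≤-trans (ℕ.≤-reflexive (ℕ.+-suc _ k)) (ℕ.+-monoˡ-≤ k longer))) }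

    -- Having a Hamiltonian path is decidable, so it suffices to refute its absence.
    conditions⇒hamiltonian : HamiltonianPath G u v
    conditions⇒hamiltonian = decidable-stable (hamiltonian? u v) λ ¬ham →
      let Q , q , uQ = simple-path (conn u v)
      in ¬hamiltonian⇒¬path ¬ham (suc n) q uQ (ℕ.m≤n+m (suc n) (length Q))

theorem1 : ∀ {n} (G : Graph n) → Connected G → ThreeK1Free G →
    (u v : Fin n) → u ≢ v →
    (HamiltonianPath G u v ⇔
      ((¬ ArticulationPoint G u × ¬ ArticulationPoint G v)
       × (∀ x → ArticulationPoint G x → u ∉ ⁅ x ⁆ × v ∉ ⁅ x ⁆ × ¬ Reach G ⁅ x ⁆ u v)
       × ¬ MinimumVertexCut G (⁅ u ⁆ ∪ ⁅ v ⁆)))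
    × (HamiltonianPath G u v ⇔
      ((¬ ArticulationPoint G u × ¬ ArticulationPoint G v)
       × (∀ x → ArticulationPoint G x → u ∉ ⁅ x ⁆ × v ∉ ⁅ x ⁆ × ¬ Reach G ⁅ x ⁆ u v)
       × ¬ VertexCut G (⁅ u ⁆ ∪ ⁅ v ⁆)))
theorem1 G conn free u v u≢v =
  mk⇔ (λ ham → ¬articulation ham , separates ham , ¬ends-cut ham ∘ proj₁)
      (λ (a , b , c) → conditions⇒hamiltonian u≢v a b c) ,
  mk⇔ (λ ham → ¬articulation ham , separates ham , ¬ends-cut ham)
      (λ (a , b , c) → conditions⇒hamiltonian u≢v a b (c ∘ proj₁))
  where
    open Necessity G
    open Sufficiency G conn free

    ¬articulation : HamiltonianPath G u v → ¬ ArticulationPoint G u × ¬ ArticulationPoint G v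
    ¬articulation ham = hamiltonian⇒start-¬articulation u≢v ham
                      , hamiltonian⇒start-¬articulation (u≢v ∘ sym) (hamiltonian-reverse ham)

    separates : HamiltonianPath G u v → ArticulationPointsSeparate u v
    separates ham x ap = end∉ (proj₁ (¬articulation ham)) , end∉ (proj₂ (¬articulation ham)) ,
                         hamiltonian⇒articulation-separates ham x ap
      where
        end∉ : ∀ {e} → ¬ ArticulationPoint G e → e ∉ ⁅ x ⁆
        end∉ ¬art-e e∈x rewrite Subset.x∈⁅y⁆⇒x≡y x e∈x = ¬art-e ap

    ¬ends-cut : HamiltonianPath G u v → ¬ VertexCut G (⁅ u ⁆ ∪ ⁅ v ⁆)
    ¬ends-cut = hamiltonian⇒ends-¬cut u≢v
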